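{- For all FEL-terms $P, Q \in \mathrm{FT}$: if $\mathrm{fe}(P) = \mathrm{fe}(Q)$ (i.e. $\mathrm{FFEL} \vDash P = Q$), then $\mathrm{EqFFEL} \vdash P = Q$.
   Context: Let $A$ be a countable set of atoms. The set $\mathrm{FT}$ of FEL-terms is generated by $P ::= a \ (a \in A) \mid \mathsf{T} \mid \mathsf{F} \mid \neg P \mid (P \wedge^{\bullet} P) \mid (P \vee^{\bullet} P)$, where $\wedge^{\bullet}$ and $\vee^{\bullet}$ denote full left-sequential conjunction and disjunction. Let $\mathcal{T}$ be the set of finite binary trees given by: $\mathsf{T}, \mathsf{F} \in \mathcal{T}$, and $(X \trianglelefteq a \trianglerighteq Y) \in \mathcal{T}$ for $X, Y \in \mathcal{T}$, $a \in A$ (root $a$, left branch $X$, right branch $Y$). Leaf replacement is defined by $\mathsf{T}[\mathsf{T}\mapsto Y, \mathsf{F}\mapsto Z] = Y$, $\mathsf{F}[\mathsf{T}\mapsto Y, \mathsf{F}\mapsto Z] = Z$, $(X' \trianglelefteq a \trianglerighteq X'')[\mathsf{T}\mapsto Y, \mathsf{F}\mapsto Z] = X'[\mathsf{T}\mapsto Y, \mathsf{F}\mapsto Z] \trianglelefteq a \trianglerighteq X''[\mathsf{T}\mapsto Y, \mathsf{F}\mapsto Z]$; a leaf not mentioned is left unchanged. The full evaluation function $\mathrm{fe}: \mathrm{FT} \to \mathcal{T}$ is: $\mathrm{fe}(\mathsf{T}) = \mathsf{T}$, $\mathrm{fe}(\mathsf{F}) = \mathsf{F}$, $\mathrm{fe}(a)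 = \mathsf{T} \trianglelefteq a \trianglerighteq \mathsf{F}$, $\mathrm{fe}(\neg P) = \mathrm{fe}(P)[\mathsf{T}\mapsto\mathsf{F}, \mathsf{F}\mapsto\mathsf{T}]$, $\mathrm{fe}(P \wedge^{\bullet} Q) = \mathrm{fe}(P)[\mathsf{T}\mapsto \mathrm{fe}(Q), \mathsf{F}\mapsto \mathrm{fe}(Q)[\mathsf{T}\mapsto\mathsf{F}]]$, $\mathrm{fe}(P \vee^{\bullet} Q) = \mathrm{fe}(P)[\mathsf{T}\mapsto \mathrm{fe}(Q)[\mathsf{F}\mapsto\mathsf{T}], \mathsf{F}\mapsto \mathrm{fe}(Q)]$. $\mathrm{FFEL} \vDash P = Q$ iff $\mathrm{fe}(P) = \mathrm{fe}(Q)$. $\mathrm{EqFFEL}$ is the set of equations: $\mathsf{F} = \neg\mathsf{T}$; $x \vee^{\bullet} y = \neg(\neg x \wedge^{\bullet} \neg y)$; $\neg\neg x = x$; $(x \wedge^{\bullet} y) \wedge^{\bullet} z = x \wedge^{\bullet} (y \wedge^{\bullet} z)$; $\mathsf{T} \wedge^{\bullet} x = x$; $x \wedge^{\bullet} \mathsf{T} = x$; $x \wedge^{\bullet} \mathsf{F} = \mathsf{F} \wedge^{\bullet} x$; $x \wedge^{\bullet} \mathsf{F} = \neg x \wedge^{\bullet} \mathsf{F}$; $(x \wedge^{\bullet} \mathsf{F}) \vee^{\bullet} y = (x \vee^{\bullet} \mathsf{T}) \wedge^{\bullet} y$; $x \vee^{\bullet} (y \wedge^{\bullet} \mathsf{F})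 = x \wedge^{\bullet} (y \vee^{\bullet} \mathsf{T})$. $\mathrm{EqFFEL} \vdash s = t$ means derivability by equational logic from $\mathrm{EqFFEL}$. -}

module Defs where

open import Data.Nat using (ℕ)

Atom : Set
Atom = ℕ

infixr 20 ¬_
infixl 15 _∧•_ _∨•_
data FT : Set where
  at   : Atom → FT
  T F  : FT
  ¬_   : FT → FT
  _∧•_ : FT → FT → FT
  _∨•_ : FT → FT → FT

data Tree : Set where
  T F : Tree
  _◁_▷_ : Tree → Atom → Tree → Tree

_[T↦_,F↦_] : Tree → Tree → Tree → Tree
T [T↦ Y ,F↦ Z ] = Y
F [T↦ Y ,F↦ Z ] = Z
(X′ ◁ a ▷ X″) [T↦ Y ,F↦ Z ] = (X′ [T↦ Y ,F↦ Z ]) ◁ a ▷ (X″ [T↦ Y ,F↦ Z ])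

_[T↦_] : Tree → Tree → Tree
X [T↦ Y ] = X [T↦ Y ,F↦ F ]

_[F↦_] : Tree → Tree → Tree
X [F↦ Z ] = X [T↦ T ,F↦ Z ]

fe : FT → Tree
fe T = T
fe F = F
fe (at a) = T ◁ a ▷ F
fe (¬ P) = fe P [T↦ F ,F↦ T ]
fe (P ∧• Q) = fe P [T↦ fe Q ,F↦ (fe Q [T↦ F ]) ]
fe (P ∨• Q) = fe P [T↦ (fe Q [F↦ T ]) ,F↦ fe Q ]

-- Derivability from EqFFEL in equational logic: the least congruence on FT
-- containing all substitution instances of the axioms of EqFFEL.
infix 4 EqFFEL⊢_≈_
data EqFFEL⊢_≈_ : FT → FT → Set where
  refl  : ∀ {x} → EqFFEL⊢ x ≈ x
  sym   : ∀ {x y} → EqFFEL⊢ x ≈ y → EqFFEL⊢ y ≈ x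
  trans : ∀ {x y z} → EqFFEL⊢ x ≈ y → EqFFEL⊢ y ≈ z → EqFFEL⊢ x ≈ z
  cong¬ : ∀ {x x′} → EqFFEL⊢ x ≈ x′ → EqFFEL⊢ ¬ x ≈ ¬ x′
  cong∧ : ∀ {x x′ y y′} → EqFFEL⊢ x ≈ x′ → EqFFEL⊢ y ≈ y′ → EqFFEL⊢ x ∧• y ≈ x′ ∧• y′
  cong∨ : ∀ {x x′ y y′} → EqFFEL⊢ x ≈ x′ → EqFFEL⊢ y ≈ y′ → EqFFEL⊢ x ∨• y ≈ x′ ∨• y′
  ax-F     : EqFFEL⊢ F ≈ ¬ T
  ax-∨     : ∀ x y → EqFFEL⊢ x ∨• y ≈ ¬ (¬ x ∧• ¬ y)
  ax-¬¬    : ∀ x → EqFFEL⊢ ¬ ¬ x ≈ x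
  ax-assoc : ∀ x y z → EqFFEL⊢ (x ∧• y) ∧• z ≈ x ∧• (y ∧• z)
  ax-T∧    : ∀ x → EqFFEL⊢ T ∧• x ≈ x
  ax-∧T    : ∀ x → EqFFEL⊢ x ∧• T ≈ x
  ax-∧F    : ∀ x → EqFFEL⊢ x ∧• F ≈ F ∧• x
  ax-∧F¬   : ∀ x → EqFFEL⊢ x ∧• F ≈ ¬ x ∧• F
  ax-∧F∨   : ∀ x y → EqFFEL⊢ (x ∧• F) ∨• y ≈ (x ∨• T) ∧• y
  ax-∨∧F   : ∀ x y → EqFFEL⊢ x ∨• (y ∧• F) ≈ x ∧• (y ∨• T)

module Submission where

-- The proof goes through normal forms.  A normal form is a block of skipped atoms
-- (conjuncts a ∨ T, evaluated only for their side effect) followed either by a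
-- constant, or by a chain (a literal combined left to right with further operands
-- by ∧ and ∨) and a trailing block of skips.
--
-- 1. Soundness: fe validates every axiom, so derivable equations have equal trees.
--    All the tree identities needed reduce to leaf replacement being a monoid action.
-- 2. Normalisation: norm P is computed by structural recursion (negation by De
--    Morgan, conjunction by concatenating chains, disjunction by duality) and
--    P = ⟦ norm P ⟧ is derivable.  Moreover norm P is valid: no operand attached by
--    an operation o itself ends in o, which rules out reassociated duplicates.
-- 3. Uniqueness: the tree of a valid normal form is a leaf or a node whose root is
--    its first atom and whose subtrees are the trees of two cofactor normal forms
--    (the first atom fixed to T or F).  A valid normal form is determined by its
--    root and its two cofactors; the delicate case, a leading literal, compares
--    where the two cofactors resume evaluating the chain.  By induction on the tree,
--    valid normal forms with the same tree are equal.
-- The theorem follows: P = ⟦ norm P ⟧ = ⟦ norm Q ⟧ = Q, the middle step by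
-- uniqueness applied to the normal forms of P and Q, whose trees agree by soundness.

open import Defs
open import Data.Bool using (Bool; true; false; not; _≟_)
open import Data.Bool.Properties using (not-involutive; not-injective; ¬-not)
open import Data.Empty using (⊥; ⊥-elim)
open import Data.List using (List; []; _∷_; _++_; length)
open import Data.List.Properties using (++-assoc; ++-identityʳ; length-++-sucʳ; length-++-≤ˡ)
open import Data.Maybe using (Maybe; just; nothing)
open import Data.Maybe.Properties using (just-injective)
open import Data.Nat using (ℕ; _≤_; _<_; s≤s)
open import Data.Nat.Properties using (≤-trans; <-≤-trans; <⇒≤; <-irrefl)
open import Data.Product using (Σ; _×_; _,_; proj₁; proj₂)
open import Data.Sum using (_⊎_; inj₁; inj₂)
open import Data.Unit using (⊤; tt)
open import Relation.Nullary using (yes; no)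
open import Relation.Binary.Bundles using (Setoid)
import Relation.Binary.Reasoning.Setoid as SetoidReasoning
open import Relation.Binary.PropositionalEquality as ≡ using (_≡_; _≢_; cong; cong₂)

negTree : Tree → Tree
negTree X = X [T↦ F ,F↦ T ]

_⟨_⟩ : Tree → Tree → Tree
X ⟨ C ⟩ = X [T↦ C ,F↦ C ]

node-cong : ∀ {a L L′ R R′} → L ≡ L′ → R ≡ R′ → (L ◁ a ▷ R) ≡ (L′ ◁ a ▷ R′)
node-cong ≡.refl ≡.refl = ≡.refl

subst-subst : ∀ X A B C D →
  (X [T↦ A ,F↦ B ]) [T↦ C ,F↦ D ] ≡ X [T↦ A [T↦ C ,F↦ D ] ,F↦ B [T↦ C ,F↦ D ] ]
subst-subst T A B C D = ≡.refl
subst-subst F A B C D = ≡.refl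
subst-subst (X ◁ a ▷ Y) A B C D = node-cong (subst-subst X A B C D) (subst-subst Y A B C D)

subst-id : ∀ X → X [T↦ T ,F↦ F ] ≡ X
subst-id T = ≡.refl
subst-id F = ≡.refl
subst-id (X ◁ a ▷ Y) = node-cong (subst-id X) (subst-id Y)

subst-cong : ∀ X {A A′ B B′} → A ≡ A′ → B ≡ B′ → X [T↦ A ,F↦ B ] ≡ X [T↦ A′ ,F↦ B′ ]
subst-cong X = cong₂ (λ A B → X [T↦ A ,F↦ B ])

negTree-involutive : ∀ X → negTree (negTree X) ≡ X
negTree-involutive X = ≡.trans (subst-subst X F T F T) (subst-id X)

collapse-subst : ∀ X A B C → (X [T↦ A ,F↦ B ]) ⟨ C ⟩ ≡ X [T↦ A ⟨ C ⟩ ,F↦ B ⟨ C ⟩ ]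
collapse-subst X A B C = subst-subst X A B C C

collapse-collapse : ∀ X A C → (X ⟨ A ⟩) ⟨ C ⟩ ≡ X ⟨ A ⟨ C ⟩ ⟩
collapse-collapse X A C = subst-subst X A A C C

collapse-negTree : ∀ X C → negTree X ⟨ C ⟩ ≡ X ⟨ C ⟩
collapse-negTree X C = subst-subst X F T C C

fe-∨ : ∀ X Y → X [T↦ Y ⟨ T ⟩ ,F↦ Y ] ≡ negTree (negTree X [T↦ negTree Y ,F↦ negTree Y ⟨ F ⟩ ])
fe-∨ X Y = begin
    X [T↦ Y ⟨ T ⟩ ,F↦ Y ]
  ≡⟨ subst-cong X (≡.sym (collapse-negTree Y T)) (≡.sym (negTree-involutive Y)) ⟩
    X [T↦ negTree Y ⟨ T ⟩ ,F↦ negTree (negTree Y) ]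
  ≡⟨ subst-cong X (≡.sym (subst-subst (negTree Y) F F F T)) ≡.refl ⟩
    X [T↦ negTree (negTree Y ⟨ F ⟩) ,F↦ negTree (negTree Y) ]
  ≡⟨ ≡.sym (subst-subst X _ _ F T) ⟩
    negTree (X [T↦ negTree Y ⟨ F ⟩ ,F↦ negTree Y ])
  ≡⟨ cong negTree (≡.sym (subst-subst X F T _ _)) ⟩
    negTree (negTree X [T↦ negTree Y ,F↦ negTree Y ⟨ F ⟩ ])
  ∎
  where open ≡.≡-Reasoning

fe-assoc : ∀ X Y Z →
  (X [T↦ Y ,F↦ Y ⟨ F ⟩ ]) [T↦ Z ,F↦ Z ⟨ F ⟩ ]
    ≡ X [T↦ Y [T↦ Z ,F↦ Z ⟨ F ⟩ ] ,F↦ (Y [T↦ Z ,F↦ Z ⟨ F ⟩ ]) ⟨ F ⟩ ]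
fe-assoc X Y Z = begin
    (X [T↦ Y ,F↦ Y ⟨ F ⟩ ]) [T↦ Z ,F↦ Z ⟨ F ⟩ ]
  ≡⟨ subst-subst X _ _ _ _ ⟩
    X [T↦ Y [T↦ Z ,F↦ Z ⟨ F ⟩ ] ,F↦ (Y ⟨ F ⟩) [T↦ Z ,F↦ Z ⟨ F ⟩ ] ]
  ≡⟨ subst-cong X ≡.refl (subst-subst Y F F _ _) ⟩
    X [T↦ Y [T↦ Z ,F↦ Z ⟨ F ⟩ ] ,F↦ Y ⟨ Z ⟨ F ⟩ ⟩ ]
  ≡⟨ subst-cong X ≡.refl (subst-cong Y ≡.refl (≡.sym (collapse-collapse Z F F))) ⟩
    X [T↦ Y [T↦ Z ,F↦ Z ⟨ F ⟩ ] ,F↦ Y [T↦ Z ⟨ F ⟩ ,F↦ (Z ⟨ F ⟩) ⟨ F ⟩ ] ]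
  ≡⟨ subst-cong X ≡.refl (≡.sym (collapse-subst Y _ _ F)) ⟩
    X [T↦ Y [T↦ Z ,F↦ Z ⟨ F ⟩ ] ,F↦ (Y [T↦ Z ,F↦ Z ⟨ F ⟩ ]) ⟨ F ⟩ ]
  ∎
  where open ≡.≡-Reasoning

soundness : ∀ {P Q} → EqFFEL⊢ P ≈ Q → fe P ≡ fe Q
soundness refl = ≡.refl
soundness (sym d) = ≡.sym (soundness d)
soundness (trans d e) = ≡.trans (soundness d) (soundness e)
soundness (cong¬ d) = cong negTree (soundness d)
soundness (cong∧ d e) = cong₂ (λ A B → A [T↦ B ,F↦ B ⟨ F ⟩ ]) (soundness d) (soundness e)
soundness (cong∨ d e) = cong₂ (λ A B → A [T↦ B ⟨ T ⟩ ,F↦ B ]) (soundness d) (soundness e)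
soundness ax-F = ≡.refl
soundness (ax-∨ x y) = fe-∨ (fe x) (fe y)
soundness (ax-¬¬ x) = negTree-involutive (fe x)
soundness (ax-assoc x y z) = fe-assoc (fe x) (fe y) (fe z)
soundness (ax-T∧ x) = ≡.refl
soundness (ax-∧T x) = subst-id (fe x)
soundness (ax-∧F x) = ≡.refl
soundness (ax-∧F¬ x) = ≡.sym (subst-subst (fe x) F T F F)
soundness (ax-∧F∨ x y) = ≡.trans (subst-subst (fe x) F F _ _) (≡.sym (subst-subst (fe x) T T _ _))
soundness (ax-∨∧F x y) = subst-cong (fe x) (subst-subst (fe y) F F T T) (≡.sym (subst-subst (fe y) T T F F))

infix 4 _≃_
_≃_ : FT → FT → Set
P ≃ Q = EqFFEL⊢ P ≈ Q

≃-setoid : Setoid _ _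
≃-setoid = record
  { Carrier = FT ; _≈_ = _≃_
  ; isEquivalence = record { refl = refl ; sym = sym ; trans = trans } }

module ≃-Reasoning = SetoidReasoning ≃-setoid

≡⇒≃ : ∀ {P Q} → P ≡ Q → P ≃ Q
≡⇒≃ ≡.refl = refl

¬T≃F : ¬ T ≃ F
¬T≃F = sym ax-F

¬F≃T : ¬ F ≃ T
¬F≃T = trans (cong¬ ax-F) (ax-¬¬ T)

¬-∧ : ∀ x y → ¬ (x ∧• y) ≃ ¬ x ∨• ¬ y
¬-∧ x y = sym (trans (ax-∨ (¬ x) (¬ y)) (cong¬ (cong∧ (ax-¬¬ x) (ax-¬¬ y))))

¬-∨ : ∀ x y → ¬ (x ∨• y) ≃ ¬ x ∧• ¬ y
¬-∨ x y = trans (cong¬ (ax-∨ x y)) (ax-¬¬ _)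

∨F : ∀ x → x ∨• F ≃ x
∨F x = trans (ax-∨ x F) (trans (cong¬ (cong∧ refl ¬F≃T)) (trans (cong¬ (ax-∧T (¬ x))) (ax-¬¬ x)))

F∧F : F ∧• F ≃ F
F∧F = trans (cong∧ ax-F refl) (trans (sym (ax-∧F¬ T)) (ax-T∧ F))

∨T : ∀ x → x ∨• T ≃ ¬ (x ∧• F)
∨T x = trans (ax-∨ x T) (trans (cong¬ (cong∧ refl ¬T≃F)) (cong¬ (sym (ax-∧F¬ x))))

¬∨T : ∀ x → ¬ x ∨• T ≃ x ∨• T
¬∨T x = trans (∨T (¬ x)) (trans (cong¬ (sym (ax-∧F¬ x))) (sym (∨T x)))

-- skip u X evaluates the atoms of u for their side effect only and continues as X.
skip : List Atom → FT → FT
skip [] X = X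
skip (a ∷ u) X = (at a ∨• T) ∧• skip u X

skip-cong : ∀ u {X Y} → X ≃ Y → skip u X ≃ skip u Y
skip-cong [] d = d
skip-cong (a ∷ u) d = cong∧ refl (skip-cong u d)

skip-++ : ∀ u v X → skip (u ++ v) X ≡ skip u (skip v X)
skip-++ [] v X = ≡.refl
skip-++ (a ∷ u) v X = cong ((at a ∨• T) ∧•_) (skip-++ u v X)

skip-∧ : ∀ u X Y → skip u X ∧• Y ≃ skip u (X ∧• Y)
skip-∧ [] X Y = refl
skip-∧ (a ∷ u) X Y = trans (ax-assoc _ _ _) (cong∧ refl (skip-∧ u X Y))

skipT-∧ : ∀ u Y → skip u T ∧• Y ≃ skip u Y
skipT-∧ u Y = trans (skip-∧ u T Y) (skip-cong u (ax-T∧ Y))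

¬-skip : ∀ u X → ¬ skip u X ≃ skip u (¬ X)
¬-skip [] X = refl
¬-skip (a ∷ u) X = begin
    ¬ ((at a ∨• T) ∧• skip u X)    ≈⟨ ¬-∧ _ _ ⟩
    ¬ (at a ∨• T) ∨• ¬ skip u X    ≈⟨ cong∨ (trans (¬-∨ _ _) (cong∧ refl ¬T≃F)) refl ⟩
    (¬ at a ∧• F) ∨• ¬ skip u X    ≈⟨ ax-∧F∨ _ _ ⟩
    (¬ at a ∨• T) ∧• ¬ skip u X    ≈⟨ cong∧ (¬∨T (at a)) (¬-skip u X) ⟩
    (at a ∨• T) ∧• skip u (¬ X)    ∎
  where open ≃-Reasoning

-- A block of skips already has the value T.
skipT-∨T : ∀ w → skip w T ∨• T ≃ skip w T
skipT-∨T w = trans (∨T _) (trans (cong¬ (skipT-∧ w F)) (trans (¬-skip w F) (skip-cong w ¬F≃T)))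

¬-∧skipT : ∀ X w → ¬ (X ∧• skip w T) ≃ ¬ X ∧• skip w T
¬-∧skipT X w = begin
    ¬ (X ∧• skip w T)        ≈⟨ ¬-∧ _ _ ⟩
    ¬ X ∨• ¬ skip w T        ≈⟨ cong∨ refl (trans (¬-skip w T) (skip-cong w ¬T≃F)) ⟩
    ¬ X ∨• skip w F          ≈⟨ cong∨ refl (sym (skipT-∧ w F)) ⟩
    ¬ X ∨• (skip w T ∧• F)   ≈⟨ ax-∨∧F _ _ ⟩
    ¬ X ∧• (skip w T ∨• T)   ≈⟨ cong∧ refl (skipT-∨T w) ⟩
    ¬ X ∧• skip w T          ∎
  where open ≃-Reasoning

atoms : FT → List Atom
atoms (at a) = a ∷ []
atoms T = []
atoms F = []
atoms (¬ P) = atoms P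
atoms (P ∧• Q) = atoms P ++ atoms Q
atoms (P ∨• Q) = atoms P ++ atoms Q

∧F-∧ : ∀ X Y u v → X ∧• F ≃ skip u F → Y ∧• F ≃ skip v F → (X ∧• Y) ∧• F ≃ skip (u ++ v) F
∧F-∧ X Y u v hX hY = begin
    (X ∧• Y) ∧• F       ≈⟨ ax-assoc _ _ _ ⟩
    X ∧• (Y ∧• F)       ≈⟨ cong∧ refl (ax-∧F Y) ⟩
    X ∧• (F ∧• Y)       ≈⟨ sym (ax-assoc _ _ _) ⟩
    (X ∧• F) ∧• Y       ≈⟨ cong∧ hX refl ⟩
    skip u F ∧• Y       ≈⟨ skip-∧ u F Y ⟩
    skip u (F ∧• Y)     ≈⟨ skip-cong u (trans (sym (ax-∧F Y)) hY) ⟩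
    skip u (skip v F)   ≡⟨ ≡.sym (skip-++ u v F) ⟩
    skip (u ++ v) F     ∎
  where open ≃-Reasoning

∧F-atoms : ∀ P → P ∧• F ≃ skip (atoms P) F
¬∧F-atoms : ∀ P → ¬ P ∧• F ≃ skip (atoms P) F
∧F-atoms (at a) = trans (sym (∨F _)) (ax-∧F∨ (at a) F)
∧F-atoms T = ax-T∧ F
∧F-atoms F = F∧F
∧F-atoms (¬ P) = ¬∧F-atoms P
∧F-atoms (P ∧• Q) = ∧F-∧ P Q _ _ (∧F-atoms P) (∧F-atoms Q)
∧F-atoms (P ∨• Q) =
  trans (ax-∧F¬ _) (trans (cong∧ (¬-∨ P Q) refl) (∧F-∧ (¬ P) (¬ Q) _ _ (¬∧F-atoms P) (¬∧F-atoms Q)))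
¬∧F-atoms P = trans (sym (ax-∧F¬ P)) (∧F-atoms P)

-- Normal forms.  A chain  lit s a ops  is the literal (a if s, ¬ a otherwise)
-- combined, left to right, with operands  skip u ⟦ d ⟧ᶜ  by the operations in ops.
data Op : Set where
  ∧o ∨o : Op

data Chain : Set
data Ops : Set

data Chain where
  lit : Bool → Atom → Ops → Chain

data Ops where
  end  : Ops
  step : Op → List Atom → Chain → Ops → Ops

data NF : Set where
  const : Bool → List Atom → NF
  chain : List Atom → Chain → List Atom → NF

binop : Op → FT → FT → FT
binop ∧o = _∧•_
binop ∨o = _∨•_

literal : Bool → Atom → FT
literal true a = at a
literal false a = ¬ at a

bool : Bool → FT
bool true = T
bool false = F

⟦_⟧ᶜ : Chain → FT
applyOps : FT → Ops → FT
⟦ lit s a ops ⟧ᶜ = applyOps (literal s a) ops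
applyOps P end = P
applyOps P (step o u d r) = applyOps (binop o P (skip u ⟦ d ⟧ᶜ)) r

⟦_⟧ : NF → FT
⟦ const b w ⟧ = skip w (bool b)
⟦ chain w c tl ⟧ = skip w (⟦ c ⟧ᶜ ∧• skip tl T)

atomsᶜ : Chain → List Atom
atomsᵒ : Ops → List Atom
atomsᶜ (lit s a ops) = a ∷ atomsᵒ ops
atomsᵒ end = []
atomsᵒ (step o u d r) = u ++ (atomsᶜ d ++ atomsᵒ r)

_++ᵒ_ : Ops → Ops → Ops
end ++ᵒ r = r
step o u d x ++ᵒ r = step o u d (x ++ᵒ r)

binop-cong : ∀ o {X X′ Y Y′} → X ≃ X′ → Y ≃ Y′ → binop o X Y ≃ binop o X′ Y′
binop-cong ∧o = cong∧
binop-cong ∨o = cong∨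

applyOps-cong : ∀ ops {X X′} → X ≃ X′ → applyOps X ops ≃ applyOps X′ ops
applyOps-cong end d = d
applyOps-cong (step o u c r) d = applyOps-cong r (binop-cong o d refl)

applyOps-++ : ∀ X x r → applyOps X (x ++ᵒ r) ≡ applyOps (applyOps X x) r
applyOps-++ X end r = ≡.refl
applyOps-++ X (step o u d x) r = applyOps-++ _ x r

dual : Op → Op
dual ∧o = ∨o
dual ∨o = ∧o

negᶜ : Chain → Chain
negᵒ : Ops → Ops
negᶜ (lit s a ops) = lit (not s) a (negᵒ ops)
negᵒ end = end
negᵒ (step o u d r) = step (dual o) u (negᶜ d) (negᵒ r)

negNF : NF → NF
negNF (const b w) = const (not b) w
negNF (chain w c tl) = chain w (negᶜ c) tl

binop-¬ : ∀ o X Y → ¬ binop o X Y ≃ binop (dual o) (¬ X) (¬ Y)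
binop-¬ ∧o X Y = ¬-∧ X Y
binop-¬ ∨o X Y = ¬-∨ X Y

negᶜ-sound : ∀ c → ¬ ⟦ c ⟧ᶜ ≃ ⟦ negᶜ c ⟧ᶜ
negᵒ-sound : ∀ ops X Y → ¬ X ≃ Y → ¬ applyOps X ops ≃ applyOps Y (negᵒ ops)
negᶜ-sound (lit true a ops) = negᵒ-sound ops (at a) (¬ at a) refl
negᶜ-sound (lit false a ops) = negᵒ-sound ops (¬ at a) (at a) (ax-¬¬ (at a))
negᵒ-sound end X Y h = h
negᵒ-sound (step o u d r) X Y h = negᵒ-sound r _ _
  (trans (binop-¬ o _ _) (binop-cong (dual o) h (trans (¬-skip u _) (skip-cong u (negᶜ-sound d)))))

negNF-sound : ∀ n → ¬ ⟦ n ⟧ ≃ ⟦ negNF n ⟧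
negNF-sound (const b w) = trans (¬-skip w _) (skip-cong w (¬bool b))
  where
  ¬bool : ∀ b → ¬ bool b ≃ bool (not b)
  ¬bool true = ¬T≃F
  ¬bool false = ¬F≃T
negNF-sound (chain w c tl) =
  trans (¬-skip w _) (skip-cong w (trans (¬-∧skipT _ tl) (cong∧ (negᶜ-sound c) refl)))

-- To conjoin two chains, the trailing ∧-operations of the right
-- chain are reassociated to the outer level, so that the operand that is
-- attached by ∧ does not itself end in ∧ (this keeps normal forms canonical).
data AllAnd : Ops → Set where
  end  : AllAnd end
  step : ∀ {u d r} → AllAnd r → AllAnd (step ∧o u d r)

applyOps-∧ : ∀ ds → AllAnd ds → ∀ X Z → applyOps (X ∧• Z) ds ≃ X ∧• applyOps Z ds
applyOps-∧ end end X Z = refl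
applyOps-∧ (step ∧o u d r) (step h) X Z = trans (applyOps-cong r (ax-assoc _ _ _)) (applyOps-∧ r h X _)

applyOps-skip : ∀ ds → AllAnd ds → ∀ u X → applyOps (skip u X) ds ≃ skip u (applyOps X ds)
applyOps-skip ds h [] X = refl
applyOps-skip ds h (a ∷ u) X = trans (applyOps-∧ ds h _ _) (cong∧ refl (applyOps-skip ds h u X))

lastOr : Op → Ops → Op
lastOr o end = o
lastOr o (step o′ u d r) = lastOr o′ r

lastOp : Ops → Maybe Op
lastOp end = nothing
lastOp (step o u d r) = just (lastOr o r)

SplitAnd : Ops → Ops × Ops → Set
SplitAnd r (i , ds) = (i ++ᵒ ds ≡ r) × AllAnd ds × (lastOp i ≢ just ∧o)

consSplit : Op → List Atom → Chain → Ops × Ops → Ops × Ops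
consSplit ∧o u d (end , ds) = end , step ∧o u d ds
consSplit ∨o u d (end , ds) = step ∨o u d end , ds
consSplit o u d (step o′ u′ d′ i , ds) = step o u d (step o′ u′ d′ i) , ds

splitAnd : Ops → Ops × Ops
splitAnd end = end , end
splitAnd (step o u d r) = consSplit o u d (splitAnd r)

consSplit-correct : ∀ o u d r p → SplitAnd r p → SplitAnd (step o u d r) (consSplit o u d p)
consSplit-correct ∧o u d r (end , ds) (e , h , l) = cong (step ∧o u d) e , step h , (λ ())
consSplit-correct ∨o u d r (end , ds) (e , h , l) = cong (step ∨o u d) e , h , (λ ())
consSplit-correct ∧o u d r (step _ _ _ _ , ds) (e , h , l) = cong (step ∧o u d) e , h , l
consSplit-correct ∨o u d r (step _ _ _ _ , ds) (e , h , l) = cong (step ∨o u d) e , h , l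

splitAnd-correct : ∀ r → SplitAnd r (splitAnd r)
splitAnd-correct end = ≡.refl , end , (λ ())
splitAnd-correct (step o u d r) = consSplit-correct o u d r (splitAnd r) (splitAnd-correct r)

-- andᶜ c u d represents  ⟦ c ⟧ᶜ ∧ skip u ⟦ d ⟧ᶜ: d without its trailing ∧-steps is
-- attached to c by one ∧-step, and the trailing ∧-steps follow at the outer level.
andᶜ : Chain → List Atom → Chain → Chain
andᶜ (lit s a ops) u (lit s′ b opsd) =
  lit s a (ops ++ᵒ step ∧o u (lit s′ b (proj₁ (splitAnd opsd))) (proj₂ (splitAnd opsd)))

andᶜ-sound : ∀ c u d → ⟦ andᶜ c u d ⟧ᶜ ≃ ⟦ c ⟧ᶜ ∧• skip u ⟦ d ⟧ᶜ
andᶜ-sound (lit s a ops) u (lit s′ b opsd) with splitAnd opsd | splitAnd-correct opsd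
... | i , ds | split , allAnd , _ = begin
    applyOps (literal s a) (ops ++ᵒ step ∧o u (lit s′ b i) ds)
      ≡⟨ applyOps-++ (literal s a) ops _ ⟩
    applyOps (applyOps (literal s a) ops ∧• skip u (applyOps (literal s′ b) i)) ds
      ≈⟨ applyOps-∧ ds allAnd _ _ ⟩
    applyOps (literal s a) ops ∧• applyOps (skip u (applyOps (literal s′ b) i)) ds
      ≈⟨ cong∧ refl (applyOps-skip ds allAnd u _) ⟩
    applyOps (literal s a) ops ∧• skip u (applyOps (applyOps (literal s′ b) i) ds)
      ≡⟨ cong (λ Z → applyOps (literal s a) ops ∧• skip u Z)
           (≡.trans (≡.sym (applyOps-++ (literal s′ b) i ds)) (cong (applyOps (literal s′ b)) split)) ⟩
    applyOps (literal s a) ops ∧• skip u (applyOps (literal s′ b) opsd)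
      ∎
  where open ≃-Reasoning

andNF : NF → NF → NF
andNF (const true w) (const b v) = const b (w ++ v)
andNF (const true w) (chain v c tl) = chain (w ++ v) c tl
andNF (const false w) m = const false (w ++ atoms ⟦ m ⟧)
andNF (chain w c tl) (const true v) = chain w c (tl ++ v)
andNF n@(chain _ _ _) m@(const false v) = const false (atoms ⟦ n ⟧ ++ atoms ⟦ m ⟧)
andNF (chain w c tl) (chain v d tl′) = chain w (andᶜ c (tl ++ v) d) tl′

andNF-sound : ∀ n m → ⟦ n ⟧ ∧• ⟦ m ⟧ ≃ ⟦ andNF n m ⟧
andNF-sound (const true w) (const b v) = trans (skipT-∧ w _) (≡⇒≃ (≡.sym (skip-++ w v _)))
andNF-sound (const true w) (chain v c tl) = trans (skipT-∧ w _) (≡⇒≃ (≡.sym (skip-++ w v _)))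
andNF-sound (const false w) m = begin
    skip w F ∧• ⟦ m ⟧                ≈⟨ skip-∧ w F _ ⟩
    skip w (F ∧• ⟦ m ⟧)              ≈⟨ skip-cong w (trans (sym (ax-∧F _)) (∧F-atoms _)) ⟩
    skip w (skip (atoms ⟦ m ⟧) F)   ≡⟨ ≡.sym (skip-++ w _ F) ⟩
    skip (w ++ atoms ⟦ m ⟧) F        ∎
  where open ≃-Reasoning
andNF-sound (chain w c tl) (const true v) = begin
    skip w (⟦ c ⟧ᶜ ∧• skip tl T) ∧• skip v T   ≈⟨ skip-∧ w _ _ ⟩
    skip w ((⟦ c ⟧ᶜ ∧• skip tl T) ∧• skip v T) ≈⟨ skip-cong w (ax-assoc _ _ _) ⟩
    skip w (⟦ c ⟧ᶜ ∧• (skip tl T ∧• skip v T)) ≈⟨ skip-cong w (cong∧ refl (skipT-∧ tl _)) ⟩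
    skip w (⟦ c ⟧ᶜ ∧• skip tl (skip v T))      ≡⟨ cong (λ Z → skip w (⟦ c ⟧ᶜ ∧• Z)) (≡.sym (skip-++ tl v T)) ⟩
    skip w (⟦ c ⟧ᶜ ∧• skip (tl ++ v) T)        ∎
  where open ≃-Reasoning
andNF-sound n@(chain w c tl) (const false v) = begin
    ⟦ n ⟧ ∧• skip v F          ≈⟨ cong∧ refl (sym (trans (skip-∧ v F F) (skip-cong v F∧F))) ⟩
    ⟦ n ⟧ ∧• (skip v F ∧• F)   ≈⟨ sym (ax-assoc _ _ _) ⟩
    (⟦ n ⟧ ∧• skip v F) ∧• F   ≈⟨ ∧F-atoms _ ⟩
    skip (atoms ⟦ n ⟧ ++ atoms (skip v F)) F ∎
  where open ≃-Reasoning
andNF-sound (chain w c tl) (chain v d tl′) = trans (skip-∧ w _ _) (skip-cong w (begin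
    (⟦ c ⟧ᶜ ∧• skip tl T) ∧• skip v (⟦ d ⟧ᶜ ∧• skip tl′ T)   ≈⟨ ax-assoc _ _ _ ⟩
    ⟦ c ⟧ᶜ ∧• (skip tl T ∧• skip v (⟦ d ⟧ᶜ ∧• skip tl′ T))   ≈⟨ cong∧ refl (skipT-∧ tl _) ⟩
    ⟦ c ⟧ᶜ ∧• skip tl (skip v (⟦ d ⟧ᶜ ∧• skip tl′ T))         ≡⟨ cong (⟦ c ⟧ᶜ ∧•_) (≡.sym (skip-++ tl v _)) ⟩
    ⟦ c ⟧ᶜ ∧• skip (tl ++ v) (⟦ d ⟧ᶜ ∧• skip tl′ T)           ≈⟨ cong∧ refl (sym (skip-∧ (tl ++ v) _ _)) ⟩
    ⟦ c ⟧ᶜ ∧• (skip (tl ++ v) ⟦ d ⟧ᶜ ∧• skip tl′ T)           ≈⟨ sym (ax-assoc _ _ _) ⟩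
    (⟦ c ⟧ᶜ ∧• skip (tl ++ v) ⟦ d ⟧ᶜ) ∧• skip tl′ T           ≈⟨ cong∧ (sym (andᶜ-sound c (tl ++ v) d)) refl ⟩
    ⟦ andᶜ c (tl ++ v) d ⟧ᶜ ∧• skip tl′ T                      ∎))
  where open ≃-Reasoning

orNF : NF → NF → NF
orNF n m = negNF (andNF (negNF n) (negNF m))

orNF-sound : ∀ n m → ⟦ n ⟧ ∨• ⟦ m ⟧ ≃ ⟦ orNF n m ⟧
orNF-sound n m = begin
    ⟦ n ⟧ ∨• ⟦ m ⟧                                ≈⟨ ax-∨ _ _ ⟩
    ¬ (¬ ⟦ n ⟧ ∧• ¬ ⟦ m ⟧)                        ≈⟨ cong¬ (cong∧ (negNF-sound n) (negNF-sound m)) ⟩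
    ¬ (⟦ negNF n ⟧ ∧• ⟦ negNF m ⟧)                ≈⟨ cong¬ (andNF-sound (negNF n) (negNF m)) ⟩
    ¬ ⟦ andNF (negNF n) (negNF m) ⟧               ≈⟨ negNF-sound (andNF (negNF n) (negNF m)) ⟩
    ⟦ orNF n m ⟧                                   ∎
  where open ≃-Reasoning

norm : FT → NF
norm (at a) = chain [] (lit true a end) []
norm T = const true []
norm F = const false []
norm (¬ P) = negNF (norm P)
norm (P ∧• Q) = andNF (norm P) (norm Q)
norm (P ∨• Q) = orNF (norm P) (norm Q)

norm-sound : ∀ P → P ≃ ⟦ norm P ⟧
norm-sound (at a) = sym (ax-∧T (at a))
norm-sound T = refl
norm-sound F = refl
norm-sound (¬ P) = trans (cong¬ (norm-sound P)) (negNF-sound (norm P))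
norm-sound (P ∧• Q) = trans (cong∧ (norm-sound P) (norm-sound Q)) (andNF-sound (norm P) (norm Q))
norm-sound (P ∨• Q) = trans (cong∨ (norm-sound P) (norm-sound Q)) (orNF-sound (norm P) (norm Q))

-- Canonicity of normal forms: an operand attached by operation o does not itself
-- end in o (otherwise associativity would give a second representation).
NotEndingIn : Op → Chain → Set
NotEndingIn o (lit s a ops) = lastOp ops ≢ just o

Validᶜ : Chain → Set
Validᵒ : Ops → Set
Validᶜ (lit s a ops) = Validᵒ ops
Validᵒ end = ⊤
Validᵒ (step o u d r) = Validᶜ d × NotEndingIn o d × Validᵒ r

ValidNF : NF → Set
ValidNF (const b w) = ⊤
ValidNF (chain w c tl) = Validᶜ c

Validᵒ-++ : ∀ x r → Validᵒ x → Validᵒ r → Validᵒ (x ++ᵒ r)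
Validᵒ-++ end r hx hr = hr
Validᵒ-++ (step o u d x) r (hd , ho , hx) hr = hd , ho , Validᵒ-++ x r hx hr

Validᵒ-split : ∀ x r → Validᵒ (x ++ᵒ r) → Validᵒ x × Validᵒ r
Validᵒ-split end r h = tt , h
Validᵒ-split (step o u d x) r (hd , ho , h) with Validᵒ-split x r h
... | hx , hr = (hd , ho , hx) , hr

-- Negation dualises the last operation, so it preserves validity.
lastOr-negᵒ : ∀ o r → lastOr (dual o) (negᵒ r) ≡ dual (lastOr o r)
lastOr-negᵒ o end = ≡.refl
lastOr-negᵒ o (step o′ u d r) = lastOr-negᵒ o′ r

dual-injective : ∀ {o o′} → dual o ≡ dual o′ → o ≡ o′
dual-injective {∧o} {∧o} e = ≡.refl
dual-injective {∨o} {∨o} e = ≡.refl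

NotEndingIn-neg : ∀ o d → NotEndingIn o d → NotEndingIn (dual o) (negᶜ d)
NotEndingIn-neg o (lit s a end) h = λ ()
NotEndingIn-neg o (lit s a (step o′ u d r)) h e =
  h (cong just (dual-injective (≡.trans (≡.sym (lastOr-negᵒ o′ r)) (just-injective e))))

validᶜ-neg : ∀ c → Validᶜ c → Validᶜ (negᶜ c)
validᵒ-neg : ∀ ops → Validᵒ ops → Validᵒ (negᵒ ops)
validᶜ-neg (lit s a ops) h = validᵒ-neg ops h
validᵒ-neg end h = tt
validᵒ-neg (step o u d r) (hd , ho , hr) = validᶜ-neg d hd , NotEndingIn-neg o d ho , validᵒ-neg r hr

validNF-neg : ∀ n → ValidNF n → ValidNF (negNF n)
validNF-neg (const b w) h = tt
validNF-neg (chain w c tl) h = validᶜ-neg c h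

-- Conjunction preserves validity: splitAnd leaves an operand not ending in ∧.
validᶜ-and : ∀ c u d → Validᶜ c → Validᶜ d → Validᶜ (andᶜ c u d)
validᶜ-and (lit s a ops) u (lit s′ b opsd) hc hd with splitAnd opsd | splitAnd-correct opsd
... | i , ds | split , _ , notAnd with Validᵒ-split i ds (≡.subst Validᵒ (≡.sym split) hd)
... | hi , hds = Validᵒ-++ ops _ hc (hi , notAnd , hds)

validNF-and : ∀ n m → ValidNF n → ValidNF m → ValidNF (andNF n m)
validNF-and (const true w) (const b v) hn hm = tt
validNF-and (const true w) (chain v c tl) hn hm = hm
validNF-and (const false w) m hn hm = tt
validNF-and (chain w c tl) (const true v) hn hm = hn
validNF-and (chain w c tl) (const false v) hn hm = tt
validNF-and (chain w c tl) (chain v d tl′) hn hm = validᶜ-and c _ d hn hm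

norm-valid : ∀ P → ValidNF (norm P)
norm-valid (at a) = tt
norm-valid T = tt
norm-valid F = tt
norm-valid (¬ P) = validNF-neg (norm P) (norm-valid P)
norm-valid (P ∧• Q) = validNF-and (norm P) (norm Q) (norm-valid P) (norm-valid Q)
norm-valid (P ∨• Q) = validNF-neg (andNF (negNF (norm P)) (negNF (norm Q)))
  (validNF-and (negNF (norm P)) (negNF (norm Q))
    (validNF-neg (norm P) (norm-valid P)) (validNF-neg (norm Q) (norm-valid Q)))

complete : List Atom → Tree → Tree
complete [] X = X
complete (a ∷ w) X = complete w X ◁ a ▷ complete w X

complete-subst : ∀ w X A B → (complete w X) [T↦ A ,F↦ B ] ≡ complete w (X [T↦ A ,F↦ B ])
complete-subst [] X A B = ≡.refl
complete-subst (a ∷ w) X A B = node-cong (complete-subst w X A B) (complete-subst w X A B)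

complete-++ : ∀ w v X → complete (w ++ v) X ≡ complete w (complete v X)
complete-++ [] v X = ≡.refl
complete-++ (a ∷ w) v X = node-cong (complete-++ w v X) (complete-++ w v X)

fe-skip : ∀ w X → fe (skip w X) ≡ complete w (fe X)
fe-skip [] X = ≡.refl
fe-skip (a ∷ w) X = node-cong (fe-skip w X) (fe-skip w X)

fe-shape : ∀ P C → fe P ⟨ C ⟩ ≡ complete (atoms P) C
fe-shape (at a) C = ≡.refl
fe-shape T C = ≡.refl
fe-shape F C = ≡.refl
fe-shape (¬ P) C = ≡.trans (collapse-negTree (fe P) C) (fe-shape P C)
fe-shape (P ∧• Q) C = begin
    (fe P [T↦ fe Q ,F↦ fe Q ⟨ F ⟩ ]) ⟨ C ⟩        ≡⟨ collapse-subst (fe P) _ _ C ⟩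
    fe P [T↦ fe Q ⟨ C ⟩ ,F↦ (fe Q ⟨ F ⟩) ⟨ C ⟩ ]   ≡⟨ subst-cong (fe P) ≡.refl (collapse-collapse (fe Q) F C) ⟩
    fe P ⟨ fe Q ⟨ C ⟩ ⟩                            ≡⟨ fe-shape P _ ⟩
    complete (atoms P) (fe Q ⟨ C ⟩)                ≡⟨ cong (complete (atoms P)) (fe-shape Q C) ⟩
    complete (atoms P) (complete (atoms Q) C)      ≡⟨ ≡.sym (complete-++ (atoms P) (atoms Q) C) ⟩
    complete (atoms P ++ atoms Q) C                ∎
  where open ≡.≡-Reasoning
fe-shape (P ∨• Q) C = begin
    (fe P [T↦ fe Q ⟨ T ⟩ ,F↦ fe Q ]) ⟨ C ⟩        ≡⟨ collapse-subst (fe P) _ _ C ⟩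
    fe P [T↦ (fe Q ⟨ T ⟩) ⟨ C ⟩ ,F↦ fe Q ⟨ C ⟩ ]   ≡⟨ subst-cong (fe P) (collapse-collapse (fe Q) T C) ≡.refl ⟩
    fe P ⟨ fe Q ⟨ C ⟩ ⟩                            ≡⟨ fe-shape P _ ⟩
    complete (atoms P) (fe Q ⟨ C ⟩)                ≡⟨ cong (complete (atoms P)) (fe-shape Q C) ⟩
    complete (atoms P) (complete (atoms Q) C)      ≡⟨ ≡.sym (complete-++ (atoms P) (atoms Q) C) ⟩
    complete (atoms P ++ atoms Q) C                ∎
  where open ≡.≡-Reasoning

atoms-skip : ∀ u X → atoms (skip u X) ≡ u ++ atoms X
atoms-skip [] X = ≡.refl
atoms-skip (a ∷ u) X = cong (a ∷_) (atoms-skip u X)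

atoms-binop : ∀ o X Y → atoms (binop o X Y) ≡ atoms X ++ atoms Y
atoms-binop ∧o X Y = ≡.refl
atoms-binop ∨o X Y = ≡.refl

atoms-⟦⟧ᶜ : ∀ c → atoms ⟦ c ⟧ᶜ ≡ atomsᶜ c
atoms-applyOps : ∀ X ops → atoms (applyOps X ops) ≡ atoms X ++ atomsᵒ ops
atoms-⟦⟧ᶜ (lit true a ops) = atoms-applyOps (at a) ops
atoms-⟦⟧ᶜ (lit false a ops) = atoms-applyOps (¬ at a) ops
atoms-applyOps X end = ≡.sym (++-identityʳ (atoms X))
atoms-applyOps X (step o u d r) = begin
    atoms (applyOps (binop o X (skip u ⟦ d ⟧ᶜ)) r)        ≡⟨ atoms-applyOps _ r ⟩
    atoms (binop o X (skip u ⟦ d ⟧ᶜ)) ++ atomsᵒ r         ≡⟨ cong (_++ atomsᵒ r) (atoms-binop o X _) ⟩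
    (atoms X ++ atoms (skip u ⟦ d ⟧ᶜ)) ++ atomsᵒ r        ≡⟨ ++-assoc (atoms X) _ _ ⟩
    atoms X ++ (atoms (skip u ⟦ d ⟧ᶜ) ++ atomsᵒ r)
      ≡⟨ cong (λ v → atoms X ++ (v ++ atomsᵒ r)) (atoms-skip u _) ⟩
    atoms X ++ ((u ++ atoms ⟦ d ⟧ᶜ) ++ atomsᵒ r)          ≡⟨ cong (atoms X ++_) (++-assoc u _ _) ⟩
    atoms X ++ (u ++ (atoms ⟦ d ⟧ᶜ ++ atomsᵒ r))
      ≡⟨ cong (λ v → atoms X ++ (u ++ (v ++ atomsᵒ r))) (atoms-⟦⟧ᶜ d) ⟩
    atoms X ++ (u ++ (atomsᶜ d ++ atomsᵒ r))              ∎
  where open ≡.≡-Reasoning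

_⊗[_]_ : Tree → Op → Tree → Tree
X ⊗[ ∧o ] Y = X [T↦ Y ,F↦ Y ⟨ F ⟩ ]
X ⊗[ ∨o ] Y = X [T↦ Y ⟨ T ⟩ ,F↦ Y ]

fe-binop : ∀ o X Y → fe (binop o X Y) ≡ fe X ⊗[ o ] fe Y
fe-binop ∧o X Y = ≡.refl
fe-binop ∨o X Y = ≡.refl

complete-⊗ : ∀ w X o Y → complete w X ⊗[ o ] Y ≡ complete w (X ⊗[ o ] Y)
complete-⊗ w X ∧o Y = complete-subst w X _ _
complete-⊗ w X ∨o Y = complete-subst w X _ _

applyOpsᵗ : Tree → Ops → Tree
applyOpsᵗ X end = X
applyOpsᵗ X (step o u d r) = applyOpsᵗ (X ⊗[ o ] fe (skip u ⟦ d ⟧ᶜ)) r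

fe-applyOps : ∀ X ops → fe (applyOps X ops) ≡ applyOpsᵗ (fe X) ops
fe-applyOps X end = ≡.refl
fe-applyOps X (step o u d r) = ≡.trans (fe-applyOps _ r) (cong (λ Z → applyOpsᵗ Z r) (fe-binop o X _))

-- Operations act on the leaves, so they commute with the atom queries above them.
applyOpsᵗ-node : ∀ L a R ops → applyOpsᵗ (L ◁ a ▷ R) ops ≡ applyOpsᵗ L ops ◁ a ▷ applyOpsᵗ R ops
applyOpsᵗ-node L a R end = ≡.refl
applyOpsᵗ-node L a R (step ∧o u d r) = applyOpsᵗ-node _ a _ r
applyOpsᵗ-node L a R (step ∨o u d r) = applyOpsᵗ-node _ a _ r

applyOpsᵗ-complete : ∀ w X ops → applyOpsᵗ (complete w X) ops ≡ complete w (applyOpsᵗ X ops)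
applyOpsᵗ-complete [] X ops = ≡.refl
applyOpsᵗ-complete (a ∷ w) X ops =
  ≡.trans (applyOpsᵗ-node _ a _ ops) (node-cong (applyOpsᵗ-complete w X ops) (applyOpsᵗ-complete w X ops))

applyOpsᵗ-++ : ∀ X x r → applyOpsᵗ X (x ++ᵒ r) ≡ applyOpsᵗ (applyOpsᵗ X x) r
applyOpsᵗ-++ X end r = ≡.refl
applyOpsᵗ-++ X (step o u d x) r = applyOpsᵗ-++ _ x r

extend : Chain → Ops → Chain
extend (lit s a o1) r = lit s a (o1 ++ᵒ r)

fe-extend : ∀ d r → fe ⟦ extend d r ⟧ᶜ ≡ applyOpsᵗ (fe ⟦ d ⟧ᶜ) r
fe-extend (lit s a o1) r = begin
    fe (applyOps (literal s a) (o1 ++ᵒ r))       ≡⟨ fe-applyOps (literal s a) (o1 ++ᵒ r) ⟩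
    applyOpsᵗ (fe (literal s a)) (o1 ++ᵒ r)      ≡⟨ applyOpsᵗ-++ _ o1 r ⟩
    applyOpsᵗ (applyOpsᵗ (fe (literal s a)) o1) r
      ≡⟨ cong (λ Z → applyOpsᵗ Z r) (≡.sym (fe-applyOps (literal s a) o1)) ⟩
    applyOpsᵗ (fe (applyOps (literal s a) o1)) r ∎
  where open ≡.≡-Reasoning

-- Fixing the value of the leading literal of a chain to a constant c,
-- c is propagated through the operations: an operation absorbing c (∧ absorbs F,
-- ∨ absorbs T) turns its operand into skipped atoms, the first one that passes c
-- on resumes evaluation with its operand and all later operations.
data Absorbs : Op → Bool → Set where
  absorb∧ : Absorbs ∧o false
  absorb∨ : Absorbs ∨o true

data Passes : Op → Bool → Set where
  pass∧ : Passes ∧o true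
  pass∨ : Passes ∨o false

absorbs? : ∀ o c → Absorbs o c ⊎ Passes o c
absorbs? ∧o false = inj₁ absorb∧
absorbs? ∧o true = inj₂ pass∧
absorbs? ∨o false = inj₂ pass∨
absorbs? ∨o true = inj₁ absorb∨

data Cofactor : Set where
  collapsed : Bool → List Atom → Cofactor
  resumed   : List Atom → Chain → Cofactor

-- run c acc ops: the cofactor of  c ops  when the atoms acc were skipped before.
-- It is defined by cases; run-absorbs and run-passes state it uniformly.
run : Bool → List Atom → Ops → Cofactor
run b acc end = collapsed b acc
run false acc (step ∧o u d r) = run false (acc ++ (u ++ atomsᶜ d)) r
run true acc (step ∧o u d r) = resumed (acc ++ u) (extend d r)
run true acc (step ∨o u d r) = run true (acc ++ (u ++ atomsᶜ d)) r
run false acc (step ∨o u d r) = resumed (acc ++ u) (extend d r)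

run-absorbs : ∀ {o c} → Absorbs o c → ∀ A u d r → run c A (step o u d r) ≡ run c (A ++ (u ++ atomsᶜ d)) r
run-absorbs absorb∧ A u d r = ≡.refl
run-absorbs absorb∨ A u d r = ≡.refl

run-passes : ∀ {o c} → Passes o c → ∀ A u d r → run c A (step o u d r) ≡ resumed (A ++ u) (extend d r)
run-passes pass∧ A u d r = ≡.refl
run-passes pass∨ A u d r = ≡.refl

cofactorNF : Cofactor → List Atom → NF
cofactorNF (collapsed b acc) tl = const b (acc ++ tl)
cofactorNF (resumed w c) tl = chain w c tl

leaf : Bool → Tree
leaf c = fe (bool c)

absorbed-prefix : ∀ {o c} → Absorbs o c → ∀ acc u d →
  complete acc (leaf c) ⊗[ o ] fe (skip u ⟦ d ⟧ᶜ) ≡ complete (acc ++ (u ++ atomsᶜ d)) (leaf c)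
absorbed-prefix {o} {c} ab acc u d = begin
    complete acc (leaf c) ⊗[ o ] Y                 ≡⟨ complete-⊗ acc (leaf c) o Y ⟩
    complete acc (leaf c ⊗[ o ] Y)                 ≡⟨ cong (complete acc) (absorbed ab) ⟩
    complete acc (Y ⟨ leaf c ⟩)                    ≡⟨ cong (complete acc) (fe-shape (skip u ⟦ d ⟧ᶜ) (leaf c)) ⟩
    complete acc (complete (atoms (skip u ⟦ d ⟧ᶜ)) (leaf c))
      ≡⟨ cong (λ v → complete acc (complete v (leaf c)))
           (≡.trans (atoms-skip u _) (cong (u ++_) (atoms-⟦⟧ᶜ d))) ⟩
    complete acc (complete (u ++ atomsᶜ d) (leaf c)) ≡⟨ ≡.sym (complete-++ acc _ (leaf c)) ⟩
    complete (acc ++ (u ++ atomsᶜ d)) (leaf c)     ∎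
  where
  open ≡.≡-Reasoning
  Y = fe (skip u ⟦ d ⟧ᶜ)
  absorbed : ∀ {o c} → Absorbs o c → leaf c ⊗[ o ] Y ≡ Y ⟨ leaf c ⟩
  absorbed absorb∧ = ≡.refl
  absorbed absorb∨ = ≡.refl

passed-prefix : ∀ {o c} → Passes o c → ∀ acc Y → complete acc (leaf c) ⊗[ o ] Y ≡ complete acc Y
passed-prefix {o} {c} pa acc Y = ≡.trans (complete-⊗ acc (leaf c) o Y) (cong (complete acc) (passed pa))
  where
  passed : ∀ {o c} → Passes o c → leaf c ⊗[ o ] Y ≡ Y
  passed pass∧ = ≡.refl
  passed pass∨ = ≡.refl

run-tree : ∀ c acc ops tl →
  applyOpsᵗ (complete acc (leaf c)) ops ⊗[ ∧o ] fe (skip tl T) ≡ fe ⟦ cofactorNF (run c acc ops) tl ⟧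
run-tree c acc end tl = begin
    complete acc (leaf c) ⊗[ ∧o ] fe (skip tl T)   ≡⟨ complete-⊗ acc (leaf c) ∧o _ ⟩
    complete acc (leaf c ⊗[ ∧o ] fe (skip tl T))   ≡⟨ cong (complete acc) (leaf-∧-skipT c) ⟩
    complete acc (complete tl (leaf c))            ≡⟨ ≡.sym (complete-++ acc tl (leaf c)) ⟩
    complete (acc ++ tl) (leaf c)                  ≡⟨ ≡.sym (fe-skip (acc ++ tl) (bool c)) ⟩
    fe (skip (acc ++ tl) (bool c))                 ∎
  where
  open ≡.≡-Reasoning
  leaf-∧-skipT : ∀ c → leaf c ⊗[ ∧o ] fe (skip tl T) ≡ complete tl (leaf c)
  leaf-∧-skipT true = fe-skip tl T
  leaf-∧-skipT false = ≡.trans (cong _⟨ F ⟩ (fe-skip tl T)) (complete-subst tl T F F)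
run-tree c acc (step o u d r) tl with absorbs? o c
... | inj₁ ab = begin
    applyOpsᵗ (complete acc (leaf c) ⊗[ o ] fe (skip u ⟦ d ⟧ᶜ)) r ⊗[ ∧o ] Z
      ≡⟨ cong (λ X → applyOpsᵗ X r ⊗[ ∧o ] Z) (absorbed-prefix ab acc u d) ⟩
    applyOpsᵗ (complete (acc ++ (u ++ atomsᶜ d)) (leaf c)) r ⊗[ ∧o ] Z
      ≡⟨ run-tree c _ r tl ⟩
    fe ⟦ cofactorNF (run c (acc ++ (u ++ atomsᶜ d)) r) tl ⟧
      ≡⟨ cong (λ x → fe ⟦ cofactorNF x tl ⟧) (≡.sym (run-absorbs ab acc u d r)) ⟩
    fe ⟦ cofactorNF (run c acc (step o u d r)) tl ⟧ ∎
  where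
  open ≡.≡-Reasoning
  Z = fe (skip tl T)
... | inj₂ pa = begin
    applyOpsᵗ (complete acc (leaf c) ⊗[ o ] fe (skip u ⟦ d ⟧ᶜ)) r ⊗[ ∧o ] Z
      ≡⟨ cong (λ X → applyOpsᵗ X r ⊗[ ∧o ] Z) (passed-prefix pa acc _) ⟩
    applyOpsᵗ (complete acc (fe (skip u ⟦ d ⟧ᶜ))) r ⊗[ ∧o ] Z
      ≡⟨ cong (λ X → applyOpsᵗ X r ⊗[ ∧o ] Z)
           (≡.trans (cong (complete acc) (fe-skip u _)) (≡.sym (complete-++ acc u _))) ⟩
    applyOpsᵗ (complete (acc ++ u) (fe ⟦ d ⟧ᶜ)) r ⊗[ ∧o ] Z
      ≡⟨ cong (_⊗[ ∧o ] Z) (applyOpsᵗ-complete (acc ++ u) _ r) ⟩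
    complete (acc ++ u) (applyOpsᵗ (fe ⟦ d ⟧ᶜ) r) ⊗[ ∧o ] Z
      ≡⟨ complete-⊗ (acc ++ u) _ ∧o Z ⟩
    complete (acc ++ u) (applyOpsᵗ (fe ⟦ d ⟧ᶜ) r ⊗[ ∧o ] Z)
      ≡⟨ cong (λ X → complete (acc ++ u) (X ⊗[ ∧o ] Z)) (≡.sym (fe-extend d r)) ⟩
    complete (acc ++ u) (fe ⟦ extend d r ⟧ᶜ ⊗[ ∧o ] Z)
      ≡⟨ ≡.sym (fe-skip (acc ++ u) _) ⟩
    fe (skip (acc ++ u) (⟦ extend d r ⟧ᶜ ∧• skip tl T))
      ≡⟨ cong (λ x → fe ⟦ cofactorNF x tl ⟧) (≡.sym (run-passes pa acc u d r)) ⟩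
    fe ⟦ cofactorNF (run c acc (step o u d r)) tl ⟧ ∎
  where
  open ≡.≡-Reasoning
  Z = fe (skip tl T)

-- Normal forms whose tree is a node, with the atom at the root and the two cofactors.
data Node : NF → Set where
  skipConst : ∀ b a w → Node (const b (a ∷ w))
  skipChain : ∀ a w c tl → Node (chain (a ∷ w) c tl)
  leading   : ∀ s a ops tl → Node (chain [] (lit s a ops) tl)

root : ∀ {n} → Node n → Atom
root (skipConst b a w) = a
root (skipChain a w c tl) = a
root (leading s a ops tl) = a

signed : Bool → Bool → Bool
signed s true = s
signed s false = not s

cofactor : Bool → ∀ {n} → Node n → NF
cofactor v (skipConst b a w) = const b w
cofactor v (skipChain a w c tl) = chain w c tl
cofactor v (leading s a ops tl) = cofactorNF (run (signed s v) [] ops) tl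

leaf-or-node : ∀ n → (Σ Bool λ b → n ≡ const b []) ⊎ Node n
leaf-or-node (const b []) = inj₁ (b , ≡.refl)
leaf-or-node (const b (a ∷ w)) = inj₂ (skipConst b a w)
leaf-or-node (chain (a ∷ w) c tl) = inj₂ (skipChain a w c tl)
leaf-or-node (chain [] (lit s a ops) tl) = inj₂ (leading s a ops tl)

fe-node : ∀ {n} (p : Node n) → fe ⟦ n ⟧ ≡ fe ⟦ cofactor true p ⟧ ◁ root p ▷ fe ⟦ cofactor false p ⟧
fe-node (skipConst b a w) = ≡.refl
fe-node (skipChain a w c tl) = ≡.refl
fe-node (leading s a ops tl) = begin
    fe (applyOps (literal s a) ops) ⊗[ ∧o ] Z
      ≡⟨ cong (_⊗[ ∧o ] Z) (fe-applyOps (literal s a) ops) ⟩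
    applyOpsᵗ (fe (literal s a)) ops ⊗[ ∧o ] Z
      ≡⟨ cong (λ X → applyOpsᵗ X ops ⊗[ ∧o ] Z) (fe-literal s) ⟩
    applyOpsᵗ (leaf s ◁ a ▷ leaf (not s)) ops ⊗[ ∧o ] Z
      ≡⟨ cong (_⊗[ ∧o ] Z) (applyOpsᵗ-node _ a _ ops) ⟩
    (applyOpsᵗ (leaf s) ops ◁ a ▷ applyOpsᵗ (leaf (not s)) ops) ⊗[ ∧o ] Z
      ≡⟨ node-cong (run-tree s [] ops tl) (run-tree (not s) [] ops tl) ⟩
    fe ⟦ cofactorNF (run s [] ops) tl ⟧ ◁ a ▷ fe ⟦ cofactorNF (run (not s) [] ops) tl ⟧ ∎
  where
  open ≡.≡-Reasoning
  Z = fe (skip tl T)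
  fe-literal : ∀ s → fe (literal s a) ≡ leaf s ◁ a ▷ leaf (not s)
  fe-literal true = ≡.refl
  fe-literal false = ≡.refl

absorbs⇒passes-not : ∀ {o c} → Absorbs o c → Passes o (not c)
absorbs⇒passes-not absorb∧ = pass∧
absorbs⇒passes-not absorb∨ = pass∨

passes⇒absorbs-not : ∀ {o c} → Passes o c → Absorbs o (not c)
passes⇒absorbs-not pass∧ = absorb∧
passes⇒absorbs-not pass∨ = absorb∨

absorber-unique : ∀ {o o′ c} → Absorbs o c → Absorbs o′ c → o ≡ o′
absorber-unique absorb∧ absorb∧ = ≡.refl
absorber-unique absorb∨ absorb∨ = ≡.refl

absorbed-differ : ∀ {o o′ c c′} → Absorbs o c → Absorbs o′ c′ → o ≢ o′ → c′ ≡ not c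
absorbed-differ absorb∧ absorb∧ o≢o′ = ⊥-elim (o≢o′ ≡.refl)
absorbed-differ absorb∧ absorb∨ o≢o′ = ≡.refl
absorbed-differ absorb∨ absorb∧ o≢o′ = ≡.refl
absorbed-differ absorb∨ absorb∨ o≢o′ = ⊥-elim (o≢o′ ≡.refl)

-- Where a cofactor resumes is measured by the number of atoms skipped before it.
ResumesAfter : ℕ → Cofactor → Set
ResumesAfter k (collapsed _ _) = ⊤
ResumesAfter k (resumed w _) = k ≤ length w

ResumesBefore : ℕ → Cofactor → Set
ResumesBefore k (collapsed _ _) = ⊥
ResumesBefore k (resumed w _) = length w < k

after≢before : ∀ k x y tl tl′ → ResumesAfter k x → ResumesBefore k y → cofactorNF x tl ≢ cofactorNF y tl′
after≢before k (resumed w c) (resumed w c′) tl tl′ k≤w w<k ≡.refl = <-irrefl ≡.refl (<-≤-trans w<k k≤w)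

resumesAfter-length : ∀ k x tl w e tl′ → ResumesAfter k x → cofactorNF x tl ≡ chain w e tl′ → k ≤ length w
resumesAfter-length k (resumed w c) tl w e tl′ k≤w ≡.refl = k≤w

-- The skipped atoms only grow along the propagation.
run-resumesAfter : ∀ c A r → ResumesAfter (length A) (run c A r)
run-resumesAfter c A end = tt
run-resumesAfter c A (step o u d r) with absorbs? o c
... | inj₁ ab rewrite run-absorbs ab A u d r = weaken (run c _ r) (length-++-≤ˡ A) (run-resumesAfter c _ r)
  where
  weaken : ∀ x {k k′} → k ≤ k′ → ResumesAfter k′ x → ResumesAfter k x
  weaken (collapsed _ _) k≤k′ _ = tt
  weaken (resumed _ _) k≤k′ h = ≤-trans k≤k′ h
... | inj₂ pa rewrite run-passes pa A u d r = length-++-≤ˡ A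

-- Operands contain at least one atom, so skipping an operand passes the point where
-- evaluation would have resumed at it.
longer : ∀ (A u : List Atom) a v → length (A ++ u) < length (A ++ (u ++ (a ∷ v)))
longer A u a v = ≡.subst (λ B → length (A ++ u) < length B) (++-assoc A u (a ∷ v))
  (≡.subst (length (A ++ u) <_) (≡.sym (length-++-sucʳ (A ++ u) a v)) (s≤s (length-++-≤ˡ (A ++ u))))

-- Propagating c and propagating not c through the same operations give different results:
-- the first operation absorbs exactly one of them.
run-separates : ∀ c A r tl → cofactorNF (run c A r) tl ≢ cofactorNF (run (not c) A r) tl
run-separates true A end tl ()
run-separates false A end tl ()
run-separates c A (step o u d@(lit s a q) r) tl e with absorbs? o c
... | inj₁ ab rewrite run-absorbs ab A u d r | run-passes (absorbs⇒passes-not ab) A u d r =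
  after≢before _ (run c _ r) (resumed (A ++ u) (extend d r)) tl tl
    (run-resumesAfter c _ r) (longer A u a (atomsᵒ q)) e
... | inj₂ pa rewrite run-passes pa A u d r | run-absorbs (passes⇒absorbs-not pa) A u d r =
  after≢before _ (run (not c) _ r) (resumed (A ++ u) (extend d r)) tl tl
    (run-resumesAfter (not c) _ r) (longer A u a (atomsᵒ q)) (≡.sym e)

data FirstPass (c : Bool) : Ops → Set where
  here  : ∀ {o u d X} → Passes o c → FirstPass c (step o u d X)
  there : ∀ {o u d X} → Absorbs o c → FirstPass c X → FirstPass c (step o u d X)

data AllAbsorb (c : Bool) : Ops → Set where
  end  : AllAbsorb c end
  step : ∀ {o u d X} → Absorbs o c → AllAbsorb c X → AllAbsorb c (step o u d X)

firstPass-or-allAbsorb : ∀ c X → FirstPass c X ⊎ AllAbsorb c X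
firstPass-or-allAbsorb c end = inj₂ end
firstPass-or-allAbsorb c (step o u d X) with absorbs? o c | firstPass-or-allAbsorb c X
... | inj₂ pa | _ = inj₁ (here pa)
... | inj₁ ab | inj₁ fp = inj₁ (there ab fp)
... | inj₁ ab | inj₂ aa = inj₂ (step ab aa)

atomsᵒ-step : ∀ (A u v w : List Atom) → (A ++ (u ++ v)) ++ w ≡ A ++ (u ++ (v ++ w))
atomsᵒ-step A u v w = ≡.trans (++-assoc A _ w) (cong (A ++_) (++-assoc u v w))

run-firstPass : ∀ c A X r → FirstPass c X → ResumesBefore (length (A ++ atomsᵒ X)) (run c A (X ++ᵒ r))
run-firstPass c A (step o u (lit s a q) X) r (here pa)
  rewrite run-passes pa A u (lit s a q) (X ++ᵒ r) = longer A u a (atomsᵒ q ++ atomsᵒ X)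
run-firstPass c A (step o u d X) r (there ab fp) rewrite run-absorbs ab A u d (X ++ᵒ r) =
  ≡.subst (λ B → ResumesBefore (length B) (run c (A ++ (u ++ atomsᶜ d)) (X ++ᵒ r)))
    (atomsᵒ-step A u (atomsᶜ d) (atomsᵒ X)) (run-firstPass c _ X r fp)

run-allAbsorb : ∀ c A X r → AllAbsorb c X → run c A (X ++ᵒ r) ≡ run c (A ++ atomsᵒ X) r
run-allAbsorb c A end r end = cong (λ B → run c B r) (≡.sym (++-identityʳ A))
run-allAbsorb c A (step o u d X) r (step ab aa) =
  ≡.trans (run-absorbs ab A u d (X ++ᵒ r))
    (≡.trans (run-allAbsorb c _ X r aa) (cong (λ B → run c B r) (atomsᵒ-step A u (atomsᶜ d) (atomsᵒ X))))

lastOr-absorbs : ∀ {c o} X → Absorbs o c → AllAbsorb c X → Absorbs (lastOr o X) c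
lastOr-absorbs end ab end = ab
lastOr-absorbs (step o′ u d X) ab (step ab′ aa) = lastOr-absorbs X ab′ aa

-- Propagating c through X and then
-- r′ differs from skipping X and propagating c′ through r′: either some step of X
-- passes c on and the first resumes too early, or X absorbs c throughout, and then
-- its last operation, which differs from o′, forces c′ = not c.
no-shift : ∀ c c′ o′ A X r′ tl → Absorbs o′ c′ → X ≢ end → lastOp X ≢ just o′ →
  cofactorNF (run c A (X ++ᵒ r′)) tl ≢ cofactorNF (run c′ (A ++ atomsᵒ X) r′) tl
no-shift c c′ o′ A end r′ tl ab′ X≢end notLast e = X≢end ≡.refl
no-shift c c′ o′ A X@(step o u d Y) r′ tl ab′ X≢end notLast e with firstPass-or-allAbsorb c X
... | inj₁ fp = after≢before _ (run c′ (A ++ atomsᵒ X) r′) (run c A (X ++ᵒ r′)) tl tl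
                  (run-resumesAfter c′ _ r′) (run-firstPass c A X r′ fp) (≡.sym e)
... | inj₂ aa@(step ab aa′) = run-separates c (A ++ atomsᵒ X) r′ tl (begin
    cofactorNF (run c (A ++ atomsᵒ X) r′) tl
      ≡⟨ cong (λ x → cofactorNF x tl) (≡.sym (run-allAbsorb c A X r′ aa)) ⟩
    cofactorNF (run c A (X ++ᵒ r′)) tl
      ≡⟨ e ⟩
    cofactorNF (run c′ (A ++ atomsᵒ X) r′) tl
      ≡⟨ cong (λ b → cofactorNF (run b (A ++ atomsᵒ X) r′) tl) c′≡not-c ⟩
    cofactorNF (run (not c) (A ++ atomsᵒ X) r′) tl  ∎)
  where
  open ≡.≡-Reasoning
  c′≡not-c : c′ ≡ not c
  c′≡not-c = absorbed-differ (lastOr-absorbs Y ab aa′) ab′ (λ eq → notLast (cong just eq))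

step-injective : ∀ {o u d r o′ u′ d′ r′} → step o u d r ≡ step o′ u′ d′ r′ → o ≡ o′ × u ≡ u′ × d ≡ d′ × r ≡ r′
step-injective ≡.refl = ≡.refl , ≡.refl , ≡.refl , ≡.refl

lit-injective : ∀ {t b x t′ b′ x′} → lit t b x ≡ lit t′ b′ x′ → t ≡ t′ × b ≡ b′ × x ≡ x′
lit-injective ≡.refl = ≡.refl , ≡.refl , ≡.refl

chain-injective : ∀ {w c tl w′ c′ tl′} → chain w c tl ≡ chain w′ c′ tl′ → w ≡ w′ × c ≡ c′ × tl ≡ tl′
chain-injective ≡.refl = ≡.refl , ≡.refl , ≡.refl

++ᵒ-identityʳ : ∀ x → x ++ᵒ end ≡ x
++ᵒ-identityʳ end = ≡.refl
++ᵒ-identityʳ (step o u d x) = cong (step o u d) (++ᵒ-identityʳ x)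

++ᵒ-split : ∀ x r x′ r′ → x ++ᵒ r ≡ x′ ++ᵒ r′ →
  (Σ Ops λ X → x′ ≡ x ++ᵒ X × r ≡ X ++ᵒ r′) ⊎ (Σ Ops λ X → x ≡ x′ ++ᵒ X × r′ ≡ X ++ᵒ r)
++ᵒ-split end r x′ r′ e = inj₁ (x′ , ≡.refl , e)
++ᵒ-split x@(step _ _ _ _) r end r′ e = inj₂ (x , ≡.refl , ≡.sym e)
++ᵒ-split (step o u d x) r (step o′ u′ d′ x′) r′ e with step-injective e
... | ≡.refl , ≡.refl , ≡.refl , e′ with ++ᵒ-split x r x′ r′ e′
...   | inj₁ (X , x′≡ , r≡) = inj₁ (X , cong (step o u d) x′≡ , r≡)
...   | inj₂ (X , x≡ , r′≡) = inj₂ (X , cong (step o u d) x≡ , r′≡)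

atomsᶜ-extend : ∀ d X → atomsᶜ (extend d X) ≡ atomsᶜ d ++ atomsᵒ X
atomsᶜ-extend (lit s a x) X = cong (a ∷_) (atomsᵒ-++ x X)
  where
  atomsᵒ-++ : ∀ x r → atomsᵒ (x ++ᵒ r) ≡ atomsᵒ x ++ atomsᵒ r
  atomsᵒ-++ end r = ≡.refl
  atomsᵒ-++ (step o u d x) r =
    ≡.trans (cong (λ z → u ++ (atomsᶜ d ++ z)) (atomsᵒ-++ x r))
      (≡.sym (atomsᵒ-step u (atomsᶜ d) (atomsᵒ x) (atomsᵒ r)))

notEndingIn-extend : ∀ {o} d X → X ≢ end → NotEndingIn o (extend d X) → lastOp X ≢ just o
notEndingIn-extend (lit s a x) end X≢end _ = ⊥-elim (X≢end ≡.refl)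
notEndingIn-extend {o} (lit s a x) (step o₂ u d X) _ h = ≡.subst (λ l → l ≢ just o) (lastOp-++ x) h
  where
  lastOr-++ : ∀ o₁ x → lastOr o₁ (x ++ᵒ step o₂ u d X) ≡ lastOr o₂ X
  lastOr-++ o₁ end = ≡.refl
  lastOr-++ o₁ (step o′ u′ d′ x) = lastOr-++ o′ x
  lastOp-++ : ∀ x → lastOp (x ++ᵒ step o₂ u d X) ≡ lastOp (step o₂ u d X)
  lastOp-++ end = ≡.refl
  lastOp-++ (step o′ u′ d′ x) = cong just (lastOr-++ o′ x)

extension-trivial : ∀ {c c′ o′} → Absorbs o′ c′ → ∀ A d X r′ tl → NotEndingIn o′ (extend d X) →
  cofactorNF (run c (A ++ atomsᶜ d) (X ++ᵒ r′)) tl ≡ cofactorNF (run c′ (A ++ atomsᶜ (extend d X)) r′) tl →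
  X ≡ end
extension-trivial ab′ A d end r′ tl _ _ = ≡.refl
extension-trivial {c} {c′} {o′} ab′ A d X@(step _ _ _ _) r′ tl notEnd e =
  ⊥-elim (no-shift c c′ o′ (A ++ atomsᶜ d) X r′ tl ab′ (λ ()) (notEndingIn-extend d X (λ ()) notEnd)
    (≡.trans e (cong (λ B → cofactorNF (run c′ B r′) tl) reassociate)))
  where
  reassociate : A ++ atomsᶜ (extend d X) ≡ (A ++ atomsᶜ d) ++ atomsᵒ X
  reassociate = ≡.trans (cong (A ++_) (atomsᶜ-extend d X)) (≡.sym (++-assoc A (atomsᶜ d) (atomsᵒ X)))

operand-unique : ∀ {c c′ o o′} → Absorbs o c → Absorbs o′ c′ → ∀ A d d′ r r′ tl →
  NotEndingIn o d → NotEndingIn o′ d′ → extend d r ≡ extend d′ r′ →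
  cofactorNF (run c (A ++ atomsᶜ d) r) tl ≡ cofactorNF (run c′ (A ++ atomsᶜ d′) r′) tl →
  d ≡ d′ × r ≡ r′
operand-unique ab ab′ A (lit t b x) (lit t′ b′ x′) r r′ tl nd nd′ e h with lit-injective e
... | ≡.refl , ≡.refl , e′ with ++ᵒ-split x r x′ r′ e′
... | inj₁ (X , ≡.refl , ≡.refl) with extension-trivial ab′ A (lit t b x) X r′ tl nd′ h
...   | ≡.refl = cong (lit t b) (≡.sym (++ᵒ-identityʳ x)) , ≡.refl
operand-unique ab ab′ A (lit t b x) (lit t b x′) r r′ tl nd nd′ e h
    | ≡.refl , ≡.refl , e′ | inj₂ (X , ≡.refl , ≡.refl) with extension-trivial ab A (lit t b x′) X r tl nd (≡.sym h)
...   | ≡.refl = cong (lit t b) (++ᵒ-identityʳ x′) , ≡.refl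

const≢chain : ∀ {b w w′ c tl} → const b w ≢ chain w′ c tl
const≢chain ()

-- Chains whose first steps both absorb their leading value: the other value resumes
-- at the first operand, so the skips before it and the resumption agree, and then
-- operand-unique applies to the absorbed cofactors.
absorbing-steps-unique : ∀ {c c′ o o′} → Absorbs o c → Absorbs o′ c′ → ∀ u d r u′ d′ r′ tl tl′ →
  Validᵒ (step o u d r) → Validᵒ (step o′ u′ d′ r′) →
  cofactorNF (run c [] (step o u d r)) tl ≡ cofactorNF (run c′ [] (step o′ u′ d′ r′)) tl′ →
  cofactorNF (run (not c) [] (step o u d r)) tl ≡ cofactorNF (run (not c′) [] (step o′ u′ d′ r′)) tl′ →
  c ≡ c′ × step o u d r ≡ step o′ u′ d′ r′ × tl ≡ tl′
absorbing-steps-unique {c} {c′} ab ab′ u d r u′ d′ r′ tl tl′ (_ , nd , _) (_ , nd′ , _) h₁ h₂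
  rewrite run-passes (absorbs⇒passes-not ab) [] u d r | run-passes (absorbs⇒passes-not ab′) [] u′ d′ r′
        | run-absorbs ab [] u d r | run-absorbs ab′ [] u′ d′ r′
  with chain-injective h₂
... | ≡.refl , ext , ≡.refl with operand-unique ab ab′ u d d′ r r′ tl nd nd′ ext h₁
... | ≡.refl , ≡.refl with c ≟ c′
... | no c≢c′ =
  ⊥-elim (run-separates c _ r tl (≡.trans h₁ (cong (λ b → cofactorNF (run b _ r) tl) (¬-not (≡.≢-sym c≢c′)))))
... | yes ≡.refl with absorber-unique ab ab′
... | ≡.refl = ≡.refl , ≡.refl , ≡.refl

-- The leading value cannot be absorbed by the first step of one chain and passed on
-- by that of the other: comparing where the cofactors resume gives a cycle of lengths.
mixed-steps-impossible : ∀ {c c′ o o′} → Absorbs o c → Passes o′ c′ → ∀ u d r u′ d′ r′ tl tl′ →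
  cofactorNF (run c [] (step o u d r)) tl ≡ cofactorNF (run c′ [] (step o′ u′ d′ r′)) tl′ →
  cofactorNF (run (not c) [] (step o u d r)) tl ≡ cofactorNF (run (not c′) [] (step o′ u′ d′ r′)) tl′ → ⊥
mixed-steps-impossible {c} {c′} ab pa u d@(lit s a q) r u′ d′@(lit s′ a′ q′) r′ tl tl′ h₁ h₂
  rewrite run-absorbs ab [] u d r | run-passes pa [] u′ d′ r′
        | run-passes (absorbs⇒passes-not ab) [] u d r | run-absorbs (passes⇒absorbs-not pa) [] u′ d′ r′ =
  <-irrefl ≡.refl (<-≤-trans (longer [] u a (atomsᵒ q))
    (≤-trans u+d≤u′ (<⇒≤ (<-≤-trans (longer [] u′ a′ (atomsᵒ q′)) u′+d′≤u))))
  where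
  u+d≤u′ : length (u ++ atomsᶜ d) ≤ length u′
  u+d≤u′ = resumesAfter-length _ (run c _ r) tl u′ _ tl′ (run-resumesAfter c _ r) h₁
  u′+d′≤u : length (u′ ++ atomsᶜ d′) ≤ length u
  u′+d′≤u = resumesAfter-length _ (run (not c′) _ r′) tl′ u _ tl (run-resumesAfter (not c′) _ r′) (≡.sym h₂)

resumes-at : ∀ {o c} → Passes o c → ∀ u d r tl →
  cofactorNF (run c [] (step o u d r)) tl ≡ chain u (extend d r) tl
resumes-at pa u d r tl = cong (λ x → cofactorNF x tl) (run-passes pa [] u d r)

at-not-not : ∀ c c′ ops ops′ tl tl′ → cofactorNF (run c [] ops) tl ≡ cofactorNF (run c′ [] ops′) tl′ →
  cofactorNF (run (not (not c)) [] ops) tl ≡ cofactorNF (run (not (not c′)) [] ops′) tl′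
at-not-not c c′ ops ops′ tl tl′ rewrite not-involutive c | not-involutive c′ = λ h → h

ops-unique : ∀ c c′ ops ops′ tl tl′ → Validᵒ ops → Validᵒ ops′ →
  cofactorNF (run c [] ops) tl ≡ cofactorNF (run c′ [] ops′) tl′ →
  cofactorNF (run (not c) [] ops) tl ≡ cofactorNF (run (not c′) [] ops′) tl′ →
  c ≡ c′ × ops ≡ ops′ × tl ≡ tl′
ops-unique c c′ end end tl tl′ _ _ ≡.refl _ = ≡.refl , ≡.refl , ≡.refl
ops-unique c c′ end (step o′ u′ d′ r′) tl tl′ _ _ h₁ h₂ with absorbs? o′ c′
... | inj₂ pa = ⊥-elim (const≢chain (≡.trans h₁ (resumes-at pa u′ d′ r′ tl′)))
... | inj₁ ab = ⊥-elim (const≢chain (≡.trans h₂ (resumes-at (absorbs⇒passes-not ab) u′ d′ r′ tl′)))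
ops-unique c c′ (step o u d r) end tl tl′ _ _ h₁ h₂ with absorbs? o c
... | inj₂ pa = ⊥-elim (const≢chain (≡.trans (≡.sym h₁) (resumes-at pa u d r tl)))
... | inj₁ ab = ⊥-elim (const≢chain (≡.trans (≡.sym h₂) (resumes-at (absorbs⇒passes-not ab) u d r tl)))
ops-unique c c′ (step o u d r) (step o′ u′ d′ r′) tl tl′ v v′ h₁ h₂ with absorbs? o c | absorbs? o′ c′
... | inj₁ ab | inj₁ ab′ = absorbing-steps-unique ab ab′ u d r u′ d′ r′ tl tl′ v v′ h₁ h₂
... | inj₁ ab | inj₂ pa′ = ⊥-elim (mixed-steps-impossible ab pa′ u d r u′ d′ r′ tl tl′ h₁ h₂)
... | inj₂ pa | inj₁ ab′ = ⊥-elim (mixed-steps-impossible ab′ pa u′ d′ r′ u d r tl′ tl (≡.sym h₁) (≡.sym h₂))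
... | inj₂ pa | inj₂ pa′
  with absorbing-steps-unique (passes⇒absorbs-not pa) (passes⇒absorbs-not pa′) u d r u′ d′ r′ tl tl′ v v′
         h₂ (at-not-not c c′ (step o u d r) (step o′ u′ d′ r′) tl tl′ h₁)
... | not-c≡not-c′ , ops≡ , tl≡ = not-injective not-c≡not-c′ , ops≡ , tl≡

run-valid : ∀ c A ops tl → Validᵒ ops → ValidNF (cofactorNF (run c A ops) tl)
run-valid c A end tl _ = tt
run-valid c A (step o u d r) tl (vd , _ , vr) with absorbs? o c
... | inj₁ ab rewrite run-absorbs ab A u d r = run-valid c _ r tl vr
... | inj₂ pa rewrite run-passes pa A u d r = extend-valid d vd
  where
  extend-valid : ∀ d → Validᶜ d → Validᶜ (extend d r)
  extend-valid (lit s a x) vx = Validᵒ-++ x r vx vr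

cofactor-valid : ∀ v {n} (p : Node n) → ValidNF n → ValidNF (cofactor v p)
cofactor-valid v (skipConst b a w) _ = tt
cofactor-valid v (skipChain a w c tl) vc = vc
cofactor-valid true (leading s a ops tl) vops = run-valid s [] ops tl vops
cofactor-valid false (leading s a ops tl) vops = run-valid (not s) [] ops tl vops

node-injective : ∀ {n m} (p : Node n) (q : Node m) → ValidNF n → ValidNF m → root p ≡ root q →
  cofactor true p ≡ cofactor true q → cofactor false p ≡ cofactor false q → n ≡ m
node-injective (skipConst b a w) (skipConst _ _ _) _ _ ≡.refl ≡.refl _ = ≡.refl
node-injective (skipChain a w c tl) (skipChain _ _ _ _) _ _ ≡.refl ≡.refl _ = ≡.refl
node-injective (skipConst b a w) (skipChain _ _ _ _) _ _ _ () _
node-injective (skipChain a w c tl) (skipConst _ _ _) _ _ _ () _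
node-injective (skipConst b a w) (leading s _ ops tl) _ _ _ e₁ e₂ =
  ⊥-elim (run-separates s [] ops tl (≡.trans (≡.sym e₁) e₂))
node-injective (skipChain a w c _) (leading s _ ops tl) _ _ _ e₁ e₂ =
  ⊥-elim (run-separates s [] ops tl (≡.trans (≡.sym e₁) e₂))
node-injective (leading s a ops tl) (skipConst _ _ _) _ _ _ e₁ e₂ =
  ⊥-elim (run-separates s [] ops tl (≡.trans e₁ (≡.sym e₂)))
node-injective (leading s a ops tl) (skipChain _ _ _ _) _ _ _ e₁ e₂ =
  ⊥-elim (run-separates s [] ops tl (≡.trans e₁ (≡.sym e₂)))
node-injective (leading s a ops tl) (leading s′ _ ops′ tl′) vn vm ≡.refl e₁ e₂
  with ops-unique s s′ ops ops′ tl tl′ vn vm e₁ e₂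
... | ≡.refl , ≡.refl , ≡.refl = ≡.refl

node-injectiveᵗ : ∀ {L a R L′ a′ R′} → (L ◁ a ▷ R) ≡ (L′ ◁ a′ ▷ R′) → L ≡ L′ × a ≡ a′ × R ≡ R′
node-injectiveᵗ ≡.refl = ≡.refl , ≡.refl , ≡.refl

leaf-injective : ∀ b b′ → leaf b ≡ leaf b′ → b ≡ b′
leaf-injective true true _ = ≡.refl
leaf-injective false false _ = ≡.refl

leaf≢node : ∀ b {L a R} → leaf b ≢ (L ◁ a ▷ R)
leaf≢node true ()
leaf≢node false ()

nf-unique : ∀ X {n m} → ValidNF n → ValidNF m → fe ⟦ n ⟧ ≡ X → fe ⟦ m ⟧ ≡ X → n ≡ m
nodes-unique : ∀ X {n m} (p : Node n) (q : Node m) → ValidNF n → ValidNF m →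
  fe ⟦ n ⟧ ≡ X → fe ⟦ m ⟧ ≡ X → n ≡ m
nf-unique X {n} {m} vn vm en em with leaf-or-node n | leaf-or-node m
... | inj₁ (b , ≡.refl) | inj₁ (b′ , ≡.refl) =
  cong (λ b → const b []) (leaf-injective b b′ (≡.trans en (≡.sym em)))
... | inj₁ (b , ≡.refl) | inj₂ q = ⊥-elim (leaf≢node b (≡.trans en (≡.trans (≡.sym em) (fe-node q))))
... | inj₂ p | inj₁ (b′ , ≡.refl) = ⊥-elim (leaf≢node b′ (≡.trans em (≡.trans (≡.sym en) (fe-node p))))
... | inj₂ p | inj₂ q = nodes-unique X p q vn vm en em
nodes-unique T p q vn vm en em with ≡.trans (≡.sym (fe-node p)) en
... | ()
nodes-unique F p q vn vm en em with ≡.trans (≡.sym (fe-node p)) en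
... | ()
nodes-unique (L ◁ a ▷ R) p q vn vm en em
  with node-injectiveᵗ (≡.trans (≡.sym (fe-node p)) en) | node-injectiveᵗ (≡.trans (≡.sym (fe-node q)) em)
... | Lp , ap , Rp | Lq , aq , Rq = node-injective p q vn vm (≡.trans ap (≡.sym aq))
  (nf-unique L (cofactor-valid true p vn) (cofactor-valid true q vm) Lp Lq)
  (nf-unique R (cofactor-valid false p vn) (cofactor-valid false q vm) Rp Rq)

mainTheorem2 : (P Q : FT) → fe P ≡ fe Q → EqFFEL⊢ P ≈ Q
mainTheorem2 P Q fe-P≡fe-Q = begin
    P            ≈⟨ norm-sound P ⟩
    ⟦ norm P ⟧   ≡⟨ cong ⟦_⟧ norm-P≡norm-Q ⟩
    ⟦ norm Q ⟧   ≈⟨ sym (norm-sound Q) ⟩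
    Q            ∎
  where
  open ≃-Reasoning
  norm-P≡norm-Q : norm P ≡ norm Q
  norm-P≡norm-Q = nf-unique (fe Q) (norm-valid P) (norm-valid Q)
    (≡.trans (≡.sym (soundness (norm-sound P))) fe-P≡fe-Q) (≡.sym (soundness (norm-sound Q)))
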